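{- Let $D$ be a digraph whose underlying graph is connected. If $D$ is locally finite and every finite cut of $D$ is balanced, then $D$ is solid.
   Context: Digraphs have no loops or parallel edges. $D$ is locally finite if every vertex has finite in- and out-degree. A cut of $D$ is an ordered pair $(V_1,V_2)$ of non-empty disjoint sets with $V_1\cup V_2=V(D)$; its size is the cardinality of the set of edges from $V_1$ to $V_2$; it is finite if this size is finite, and balanced if its size equals the size of $(V_2,V_1)$. $D$ is solid if $D-X$ has only finitely many strong components for every finite $X\subseteq V(D)$. -}

module Defs where

open import Data.Bool using (Bool; true; false; not)
open import Data.Nat using (ℕ)
open import Data.Fin using (Fin)
open import Data.List using (List)
open import Data.List.Membership.Propositional using (_∈_; _∉_)
open import Data.Product using (Σ; ∃; _×_; _,_)
open import Function.Bundles using (_↔_)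
open import Relation.Nullary using (¬_)
open import Relation.Binary.PropositionalEquality using (_≡_)

-- No loops; no parallel edges (at most one edge u → v, i.e. _⇒_ is
-- proof-irrelevant).  Edges u → v and v → u may both be present.
record Digraph : Set₁ where
  field
    V       : Set
    _⇒_     : V → V → Set
    loopless : ∀ v → ¬ (v ⇒ v)
    simple   : ∀ {u v} (p q : u ⇒ v) → p ≡ q

module _ (D : Digraph) where
  open Digraph D

  HasSize : Set → ℕ → Set
  HasSize A n = Fin n ↔ A

  FiniteSet : Set → Set
  FiniteSet A = ∃ λ n → HasSize A n

  LocallyFinite : Set
  LocallyFinite = ∀ v → FiniteSet (Σ V λ w → v ⇒ w)
                      × FiniteSet (Σ V λ w → w ⇒ v)

  data UWalk : V → V → Set where
    stay : ∀ {u} → UWalk u u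
    fwd  : ∀ {u w v} → u ⇒ w → UWalk w v → UWalk u v
    bwd  : ∀ {u w v} → w ⇒ u → UWalk w v → UWalk u v

  UnderlyingConnected : Set
  UnderlyingConnected = ∀ u v → UWalk u v

  -- A cut (V₁,V₂) is given by its characteristic function S : V → Bool,
  -- V₁ = {v | S v ≡ true}, V₂ = {v | S v ≡ false}; both non-empty.
  IsCut : (V → Bool) → Set
  IsCut S = (∃ λ v → S v ≡ true) × (∃ λ v → S v ≡ false)

  EdgesFrom : (V → Bool) → Bool → Set
  EdgesFrom S b = Σ V λ u → Σ V λ v → (S u ≡ b) × (S v ≡ not b) × (u ⇒ v)

  FiniteCut : (V → Bool) → Set
  FiniteCut S = FiniteSet (EdgesFrom S true)

  -- balanced: |E(V₁,V₂)| = |E(V₂,V₁)| (equal cardinality = bijection)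
  BalancedCut : (V → Bool) → Set
  BalancedCut S = EdgesFrom S true ↔ EdgesFrom S false

  data Walk (X : List V) : V → V → Set where
    stay : ∀ {u} → u ∉ X → Walk X u u
    step : ∀ {u w v} → u ∉ X → u ⇒ w → Walk X w v → Walk X u v

  StronglyConnected : List V → V → V → Set
  StronglyConnected X u v = Walk X u v × Walk X v u

  -- D - X has only finitely many strong components: there are finitely
  -- many vertices of D - X such that every vertex of D - X lies in the
  -- strong component of one of them.
  FinitelyManyStrongComponents : List V → Set
  FinitelyManyStrongComponents X =
    ∃ λ (rs : List V) → (∀ r → r ∈ rs → r ∉ X)
      × (∀ v → v ∉ X → ∃ λ r → r ∈ rs × StronglyConnected X v r)

  Solid : Set
  Solid = ∀ (X : List V) → FinitelyManyStrongComponents X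

-- Everything rests on one consequence of balance: if only finitely many edges
-- leave a set P of vertices with P ≠ ∅ ≠ V − P, then only finitely many edges
-- enter P, and (by connectivity) at least one edge leaves P.
--
-- Fix a finite X ≠ ∅ and write ↝ for reachability in D − X.  A set closed
-- forwards under the edges of D − X can only be left along edges into X, a set
-- closed backwards only entered along edges out of X, and by local finiteness
-- there are finitely many of those.
-- Every vertex of D − X is reached from a head of an edge out of X, so if D − X
-- had infinitely many strong components, some vertex u would reach infinitely
-- many of them.  Applying the principle to {w | ¬ w ↝ u} shows that such a u
-- has such a z strictly below it (u ↝ z but ¬ z ↝ u); iterating gives a chain
-- K₀ ≻ K₁ ≻ ⋯.  Every Kₙ reaches the tail of one of the finitely many edges
-- into X, so by pigeonhole the set W of vertices reached from all Kₙ is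
-- non-empty.  W is closed forwards, so it has finitely many entering edges; each
-- walk from Kₙ ∉ W into W uses one of them, and by pigeonhole again the tail of
-- one of them is reached from every Kₙ, i.e. lies in W: a contradiction.
-- For X = ∅ the principle directly shows that D is strongly connected.

module Submission where

open import Defs
open import Level using (0ℓ)
open import Axiom.ExcludedMiddle using (ExcludedMiddle)
open import Axiom.DoubleNegationElimination using (em⇒dne)
open import Data.Bool using (Bool; true; false)
open import Data.Empty using (⊥-elim)
open import Data.Fin using (Fin; zero; suc)
open import Data.List using (List; []; _∷_; _++_; length; lookup; map; tabulate; concatMap; deduplicate)
open import Data.List.Relation.Unary.Any using (here; there; index)
open import Data.List.Relation.Unary.Any.Properties using (lookup-index; ¬Any[])
open import Data.List.Relation.Unary.Unique.DecPropositional.Properties using (deduplicate-!)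
open import Data.List.Membership.Propositional using (_∈_; _∉_; lose)
open import Data.List.Membership.Propositional.Properties
  using (∈-map⁺; ∈-++⁺ˡ; ∈-++⁺ʳ; ∈-++⁻; ∈-tabulate⁺; ∈-lookup; ∈-deduplicate⁺; ∈-concatMap⁺)
open import Data.List.Membership.Propositional.Properties.WithK using (unique⇒irrelevant)
open import Data.Nat using (ℕ; suc; _⊔_; _≤′_; ≤′-refl; ≤′-step)
open import Data.Nat.Properties using (≤⇒≤′; m≤m⊔n; m≤n⊔m)
open import Data.Nat.GeneralisedArithmetic using (fold)
open import Data.Product using (Σ; ∃; _×_; _,_; proj₁; proj₂)
open import Data.Sum using (_⊎_; inj₁; inj₂; [_,_]′)
open import Function using (_∘_; Injective; case_of_)
open import Function.Bundles using (_↔_; Inverse; mk↔ₛ′)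
open import Relation.Nullary using (¬_; yes; no; does)
open import Relation.Nullary.Decidable using (dec-true; dec-false)
open import Relation.Unary using (_⊆_)
open import Relation.Binary.Definitions using (DecidableEquality)
open import Relation.Binary.PropositionalEquality using (_≡_; refl; sym; trans; cong; subst)
open import Relation.Binary.PropositionalEquality.WithK using (≡-irrelevant)

Enumerable : Set → Set
Enumerable A = Σ (List A) λ xs → ∀ x → x ∈ xs

finite⇒enumerable : ∀ {A : Set} {n} → Fin n ↔ A → Enumerable A
finite⇒enumerable f = tabulate to , λ x →
  subst (_∈ tabulate to) (strictlyInverseˡ x) (∈-tabulate⁺ (from x))
  where open Inverse f

index-∈-lookup : ∀ {A : Set} (xs : List A) i → index (∈-lookup {xs = xs} i) ≡ i
index-∈-lookup (x ∷ xs) zero    = refl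
index-∈-lookup (x ∷ xs) (suc i) = cong suc (index-∈-lookup xs i)

infinite-chain : ∀ {A : Set} {B : A → Set} (R : A → A → Set) →
  (∀ {u} → B u → ∃ λ z → R u z × B z) →
  ∀ {u} → B u → Σ (ℕ → A) λ K → ∀ n → R (K n) (K (suc n))
infinite-chain {A} {B} R next {u} bu = proj₁ ∘ chain , λ n → proj₁ (proj₂ (next (proj₂ (chain n))))
  where
  chain : ℕ → Σ A B
  chain = fold (u , bu) λ (v , bv) → proj₁ (next bv) , proj₂ (proj₂ (next bv))

module Classical (em : ExcludedMiddle 0ℓ) where

  dne : {P : Set} → ¬ ¬ P → P
  dne = em⇒dne em

  module _ {A : Set} where

    _≟_ : DecidableEquality A
    x ≟ y = em

    enumerable⇒finite : Enumerable A → ∃ λ n → Fin n ↔ A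
    enumerable⇒finite (xs , xs-complete) =
      length ys , mk↔ₛ′ (lookup ys) (index ∘ ∈ys) (sym ∘ lookup-index ∘ ∈ys) index-∈ys
      where
      ys = deduplicate _≟_ xs
      ∈ys : ∀ x → x ∈ ys
      ∈ys x = ∈-deduplicate⁺ _≟_ (xs-complete x)
      index-∈ys : ∀ i → index (∈ys (lookup ys i)) ≡ i
      index-∈ys i = trans (cong index (unique⇒irrelevant (deduplicate-! _≟_ xs) _ _)) (index-∈-lookup ys i)

    enumerable-by-injection : {B : Set} (f : A → B) → Injective _≡_ _≡_ f →
      (bs : List B) → (∀ a → f a ∈ bs) → Enumerable A
    enumerable-by-injection {B} f f-injective bs bs-complete =
      preimages bs , λ a → ∈-preimages (bs-complete a)
      where
      preimages : List B → List A
      preimages [] = []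
      preimages (b ∷ bs) with em {Σ A λ a → f a ≡ b}
      ... | yes (a , _) = a ∷ preimages bs
      ... | no _        = preimages bs

      ∈-preimages : ∀ {a bs} → f a ∈ bs → a ∈ preimages bs
      ∈-preimages {a} {b ∷ bs} fa∈ with em {Σ A λ a → f a ≡ b} | fa∈
      ... | yes (a′ , fa′≡b) | here fa≡b  = here (f-injective (subst (f a ≡_) (sym fa′≡b) fa≡b))
      ... | yes _            | there fa∈′ = there (∈-preimages fa∈′)
      ... | no ∄a            | here fa≡b  = ⊥-elim (∄a (a , fa≡b))
      ... | no _             | there fa∈′ = ∈-preimages fa∈′

    descending-pigeonhole : (P : ℕ → A → Set) → (∀ {n a} → P (suc n) a → P n a) →
      (xs : List A) → (∀ n → ∃ λ a → a ∈ xs × P n a) → ∃ λ a → a ∈ xs × ∀ n → P n a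
    descending-pigeonhole P down [] some = ⊥-elim (¬Any[] (proj₁ (proj₂ (some 0))))
    descending-pigeonhole P down (x ∷ xs) some with em {∀ n → P n x}
    ... | yes all = x , here refl , all
    -- If P m x fails, then from stage m on all witnesses lie in xs.
    ... | no ¬all with dne (λ no-m → ¬all λ n → dne λ ¬Pnx → no-m (n , ¬Pnx))
    ... | m , ¬Pmx = let a , a∈xs , all = descending-pigeonhole P down xs some′ in a , there a∈xs , all
      where
      lower : ∀ {k n a} → k ≤′ n → P n a → P k a
      lower ≤′-refl        p = p
      lower (≤′-step k≤′n) p = lower k≤′n (down p)

      some′ : ∀ n → ∃ λ a → a ∈ xs × P n a
      some′ n with some (n ⊔ m)
      ... | a , here refl , p  = ⊥-elim (¬Pmx (lower (≤⇒≤′ (m≤n⊔m n m)) p))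
      ... | a , there a∈xs , p = a , a∈xs , lower (≤⇒≤′ (m≤m⊔n n m)) p

module Cuts (em : ExcludedMiddle 0ℓ) (D : Digraph) where
  open Digraph D
  open Classical em

  Leaving Entering : (V → Set) → V × V → Set
  Leaving  P (u , v) = P u × ¬ P v × u ⇒ v
  Entering P (u , v) = ¬ P u × P v × u ⇒ v

  EdgeCover : (V × V → Set) → Set
  EdgeCover E = Σ (List (V × V)) λ L → E ⊆ (_∈ L)

  side : (V → Set) → V → Bool
  side P v = does (em {P v})

  side-true : ∀ {P v} → side P v ≡ true → P v
  side-true {P} {v} with em {P v}
  ... | yes p = λ _ → p
  ... | no _  = λ ()

  side-false : ∀ {P v} → side P v ≡ false → ¬ P v
  side-false {P} {v} with em {P v}
  ... | yes _ = λ ()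
  ... | no ¬p = λ _ → ¬p

  ends : ∀ {S b} → EdgesFrom D S b → V × V
  ends (u , v , _) = u , v

  ends-injective : ∀ {S b} → Injective _≡_ _≡_ (ends {S} {b})
  ends-injective {x = u , v , p , q , e} {.u , .v , p′ , q′ , e′} refl
    rewrite ≡-irrelevant p p′ | ≡-irrelevant q q′ | simple e e′ = refl

  edgeFrom⇒leaving : ∀ {P} (ε : EdgesFrom D (side P) true) → Leaving P (ends ε)
  edgeFrom⇒leaving {P} (u , v , pu , ¬pv , e) = side-true {P} pu , side-false {P} ¬pv , e

  entering⇒edgeFrom : ∀ {P u v} → Entering P (u , v) → EdgesFrom D (side P) false
  entering⇒edgeFrom {P} {u} {v} (¬pu , pv , e) = u , v , dec-false em ¬pu , dec-true em pv , e

  finiteCut : ∀ {P} → EdgeCover (Leaving P) → FiniteCut D (side P)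
  finiteCut (L , L-complete) = enumerable⇒finite
    (enumerable-by-injection ends ends-injective L (L-complete ∘ edgeFrom⇒leaving))

  crossing : ∀ {P x y} → UWalk D x y → P x → ¬ P y → ∃ (Leaving P) ⊎ ∃ (Entering P)
  crossing stay px ¬py = ⊥-elim (¬py px)
  crossing {P} (fwd {w = w} e walk) px ¬py with em {P w}
  ... | yes pw = crossing walk pw ¬py
  ... | no ¬pw = inj₁ (_ , px , ¬pw , e)
  crossing {P} (bwd {w = w} e walk) px ¬py with em {P w}
  ... | yes pw = crossing walk pw ¬py
  ... | no ¬pw = inj₂ (_ , ¬pw , px , e)

module BalancedCuts (em : ExcludedMiddle 0ℓ) (D : Digraph) (conn : UnderlyingConnected D)
  (bal : ∀ (S : Digraph.V D → Bool) → IsCut D S → FiniteCut D S → BalancedCut D S) where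
  open Digraph D
  open Classical em
  open Cuts em D

  module _ {P : V → Set} {a b : V} (pa : P a) (¬pb : ¬ P b) where

    balance : EdgeCover (Leaving P) → EdgesFrom D (side P) true ↔ EdgesFrom D (side P) false
    balance cover = bal (side P) ((a , dec-true em pa) , (b , dec-false em ¬pb)) (finiteCut cover)

    entering-cover : EdgeCover (Leaving P) → EdgeCover (Entering P)
    entering-cover cover = map (ends ∘ to) εs , λ {(u , v)} entering →
      let ε = entering⇒edgeFrom entering in
      subst (_∈ map (ends ∘ to) εs) (cong ends (strictlyInverseˡ ε)) (∈-map⁺ (ends ∘ to) (εs-complete (from ε)))
      where
      open Inverse (balance cover)
      εs = proj₁ (finite⇒enumerable (proj₂ (finiteCut cover)))
      εs-complete = proj₂ (finite⇒enumerable (proj₂ (finiteCut cover)))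

    -- A walk from a to b crosses the cut; if it crosses backwards, balance
    -- (for the empty set of leaving edges) yields a leaving edge after all.
    some-edge-leaves : ∃ (Leaving P)
    some-edge-leaves = dne λ none →
      [ none , (λ (_ , entering) → none (_ , edgeFrom⇒leaving (from none (entering⇒edgeFrom entering)))) ]′
        (crossing (conn a b) pa ¬pb)
      where
      from : ¬ ∃ (Leaving P) → EdgesFrom D (side P) false → EdgesFrom D (side P) true
      from none = Inverse.from (balance ([] , λ leaving → ⊥-elim (none (_ , leaving))))

module LocallyFiniteEdges (D : Digraph) (lf : LocallyFinite D) where
  open Digraph D

  outEdgesAt : ∀ x → Enumerable (Σ V (x ⇒_))
  outEdgesAt x = finite⇒enumerable (proj₂ (proj₁ (lf x)))

  inEdgesAt : ∀ x → Enumerable (Σ V (_⇒ x))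
  inEdgesAt x = finite⇒enumerable (proj₂ (proj₂ (lf x)))

  edgesOutOf edgesInto : List V → List (V × V)
  edgesOutOf = concatMap λ x → map ((x ,_) ∘ proj₁) (proj₁ (outEdgesAt x))
  edgesInto  = concatMap λ x → map ((_, x) ∘ proj₁) (proj₁ (inEdgesAt x))

  ∈-edgesOutOf : ∀ {X x v} → x ∈ X → x ⇒ v → (x , v) ∈ edgesOutOf X
  ∈-edgesOutOf {x = x} x∈X e =
    ∈-concatMap⁺ _ (lose x∈X (∈-map⁺ ((x ,_) ∘ proj₁) (proj₂ (outEdgesAt x) (_ , e))))

  ∈-edgesInto : ∀ {X x u} → x ∈ X → u ⇒ x → (u , x) ∈ edgesInto X
  ∈-edgesInto {x = x} x∈X e =
    ∈-concatMap⁺ _ (lose x∈X (∈-map⁺ ((_, x) ∘ proj₁) (proj₂ (inEdgesAt x) (_ , e))))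

module Solidity (em : ExcludedMiddle 0ℓ) (D : Digraph)
  (conn : UnderlyingConnected D) (lf : LocallyFinite D)
  (bal : ∀ (S : Digraph.V D → Bool) → IsCut D S → FiniteCut D S → BalancedCut D S) where
  open Digraph D
  open Classical em
  open Cuts em D
  open BalancedCuts em D conn bal
  open LocallyFiniteEdges D lf

  module Avoiding (X : List V) where

    infix 4 _↝_ _≻_

    _↝_ : V → V → Set
    _↝_ = Walk D X

    _≻_ : V → V → Set
    u ≻ z = u ↝ z × ¬ z ↝ u

    source∉ : ∀ {u v} → u ↝ v → u ∉ X
    source∉ (stay u∉X)     = u∉X
    source∉ (step u∉X _ _) = u∉X

    target∉ : ∀ {u v} → u ↝ v → v ∉ X
    target∉ (stay v∉X)    = v∉X
    target∉ (step _ _ vw) = target∉ vw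

    _++ʷ_ : ∀ {u v w} → u ↝ v → v ↝ w → u ↝ w
    stay _       ++ʷ vw = vw
    step u∉X e p ++ʷ vw = step u∉X e (p ++ʷ vw)

    extend : ∀ {u v w} → u ↝ v → v ⇒ w → w ∉ X → u ↝ w
    extend uv e w∉X = uv ++ʷ step (target∉ uv) e (stay w∉X)

    walk-crossing : ∀ (Q : V → Set) {a b} → a ↝ b → ¬ Q a → Q b →
      ∃ λ yz → a ↝ proj₁ yz × Entering Q yz × proj₂ yz ↝ b
    walk-crossing Q (stay _) ¬qa qb = ⊥-elim (¬qa qb)
    walk-crossing Q (step {w = w} a∉X e wb) ¬qa qb with em {Q w}
    ... | yes qw = _ , stay a∉X , (¬qa , qw , e) , wb
    ... | no ¬qw = let yz , wy , entering , zb = walk-crossing Q wb ¬qw qb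
                   in yz , step a∉X e wy , entering , zb

    ForwardClosed BackwardClosed : (V → Set) → Set
    ForwardClosed  P = ∀ {u v} → P u → u ⇒ v → v ∉ X → P v
    BackwardClosed P = ∀ {u v} → P v → u ⇒ v → u ∉ X → P u

    leaving-head∈X : ∀ {P u v} → ForwardClosed P → Leaving P (u , v) → v ∈ X
    leaving-head∈X closed (pu , ¬pv , e) = dne λ v∉X → ¬pv (closed pu e v∉X)

    leaving-tail∈X : ∀ {Q u v} → BackwardClosed Q → Leaving (¬_ ∘ Q) (u , v) → u ∈ X
    leaving-tail∈X closed (¬qu , ¬¬qv , e) = dne λ u∉X → ¬qu (closed (dne ¬¬qv) e u∉X)

    leaving-cover-in : ∀ {P} → ForwardClosed P → EdgeCover (Leaving P)
    leaving-cover-in closed = edgesInto X , λ {(u , v)} leaving →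
      ∈-edgesInto (leaving-head∈X closed leaving) (proj₂ (proj₂ leaving))

    leaving-cover-out : ∀ {Q} → BackwardClosed Q → EdgeCover (Leaving (¬_ ∘ Q))
    leaving-cover-out closed = edgesOutOf X , λ {(u , v)} leaving →
      ∈-edgesOutOf (leaving-tail∈X closed leaving) (proj₂ (proj₂ leaving))

    reachable-forwardClosed : ∀ {u} → ForwardClosed (u ↝_)
    reachable-forwardClosed = extend

    reaching-backwardClosed : ∀ {v} → BackwardClosed (_↝ v)
    reaching-backwardClosed wv e u∉X = step u∉X e wv

    reached-from-X : ∀ {x₀ v} → x₀ ∈ X → v ∉ X → ∃ λ e → e ∈ edgesOutOf X × proj₂ e ↝ v
    reached-from-X {x₀} {v} x₀∈X v∉X =
      let e , leaving = some-edge-leaves {P = λ w → ¬ w ↝ v} {x₀} {v}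
                          (λ x₀↝v → source∉ x₀↝v x₀∈X) (λ ¬v↝v → ¬v↝v (stay v∉X))
      in e , proj₂ (leaving-cover-out reaching-backwardClosed) leaving , dne (proj₁ (proj₂ leaving))

    reaches-X : ∀ {x₀ v} → x₀ ∈ X → v ∉ X → ∃ λ e → e ∈ edgesInto X × v ↝ proj₁ e
    reaches-X {x₀} {v} x₀∈X v∉X =
      let e , leaving = some-edge-leaves {P = v ↝_} {v} {x₀} (stay v∉X) (λ v↝x₀ → target∉ v↝x₀ x₀∈X)
      in e , proj₂ (leaving-cover-in reachable-forwardClosed) leaving , proj₁ leaving

    ComponentCover : (V → Set) → Set
    ComponentCover P = Σ (List V) λ rs → (∀ r → r ∈ rs → r ∉ X) ×
                       (∀ v → P v → ∃ λ r → r ∈ rs × StronglyConnected D X v r)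

    cover-⋃ : {A : Set} (Q : A → V → Set) (zs : List A) →
      ComponentCover (λ v → ∃ λ z → z ∈ zs × ComponentCover (Q z) × Q z v)
    cover-⋃ Q [] = [] , (λ _ ()) , λ { _ (_ , () , _) }
    cover-⋃ Q (z ∷ zs) with cover-⋃ Q zs | em {ComponentCover (Q z)}
    ... | rs , rs∉X , covered | no ¬cover = rs , rs∉X , λ where
      v (_ , here refl , cover , _)  → ⊥-elim (¬cover cover)
      v (z′ , there z′∈ , cover , q) → covered v (z′ , z′∈ , cover , q)
    ... | rs , rs∉X , covered | yes (rs₀ , rs₀∉X , covered₀) = rs₀ ++ rs ,
      (λ r r∈ → [ rs₀∉X r , rs∉X r ]′ (∈-++⁻ rs₀ r∈)) , λ where
        v (_ , here refl , _ , q) → let r , r∈ , v≋r = covered₀ v q in r , ∈-++⁺ˡ r∈ , v≋r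
        v (z′ , there z′∈ , cover , q) →
          let r , r∈ , v≋r = covered v (z′ , z′∈ , cover , q) in r , ∈-++⁺ʳ rs₀ r∈ , v≋r

    cover-from-below : ∀ {u} → u ∉ X → (L : List (V × V)) → Entering (λ w → ¬ w ↝ u) ⊆ (_∈ L) →
      (∀ {z} → u ≻ z → ComponentCover (z ↝_)) → ComponentCover (u ↝_)
    cover-from-below {u} u∉X L L-complete below-covered =
      u ∷ reps , (λ { _ (here refl) → u∉X ; r (there r∈) → reps∉X r r∈ }) , represent
      where
      covering = cover-⋃ (λ e → proj₂ e ↝_) L
      reps = proj₁ covering
      reps∉X = proj₁ (proj₂ covering)
      represent : ∀ v → u ↝ v → ∃ λ r → r ∈ u ∷ reps × StronglyConnected D X v r
      represent v u↝v = case em {v ↝ u} of λ where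
        (yes v↝u) → u , here refl , v↝u , u↝v
        (no ¬v↝u) →
          let e , u↝y , entering , z↝v = walk-crossing (λ w → ¬ w ↝ u) u↝v (λ ¬u↝u → ¬u↝u (stay u∉X)) ¬v↝u
              _ , ¬z↝u , y⇒z = entering
              r , r∈ , v≋r = proj₂ (proj₂ covering) v
                (e , L-complete entering , below-covered (extend u↝y y⇒z (source∉ z↝v) , ¬z↝u) , z↝v)
          in r , there r∈ , v≋r

    ReachesInfinitelyMany : V → Set
    ReachesInfinitelyMany u = ¬ ComponentCover (u ↝_)

    reachesInfinitelyMany⇒∉X : ∀ {u} → ReachesInfinitelyMany u → u ∉ X
    reachesInfinitelyMany⇒∉X infinite u∈X = infinite ([] , (λ _ ()) , λ v u↝v → ⊥-elim (source∉ u↝v u∈X))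

    descend : ∀ {x₀ u} → x₀ ∈ X → ReachesInfinitelyMany u → ∃ λ z → u ≻ z × ReachesInfinitelyMany z
    descend {x₀} {u} x₀∈X infinite = dne λ none →
      let u∉X = reachesInfinitelyMany⇒∉X infinite
          L , L-complete = entering-cover {P = λ w → ¬ w ↝ u} {x₀} {u}
                             (λ x₀↝u → source∉ x₀↝u x₀∈X) (λ ¬u↝u → ¬u↝u (stay u∉X))
                             (leaving-cover-out reaching-backwardClosed)
      in infinite (cover-from-below u∉X L L-complete λ u≻z → dne λ inf → none (_ , u≻z , inf))

    Descending : (ℕ → V) → Set
    Descending K = ∀ n → K n ≻ K (suc n)

    ReachedFromAll : (ℕ → V) → V → Set
    ReachedFromAll K v = ∀ n → K n ↝ v

    reachedFromAll-nonempty : ∀ {x₀ K} → x₀ ∈ X → Descending K → ∃ (ReachedFromAll K)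
    reachedFromAll-nonempty {K = K} x₀∈X desc =
      let e , _ , all = descending-pigeonhole (λ n e → K n ↝ proj₁ e) (proj₁ (desc _) ++ʷ_) (edgesInto X)
                          λ n → reaches-X x₀∈X (source∉ (proj₁ (desc n)))
      in proj₁ e , all

    -- Kₙ lies outside the set, as Kₙ₊₁ does not reach it, so each walk from Kₙ to
    -- t enters the set; pigeonhole then puts the tail of an entering edge inside.
    reachedFromAll-infinitelyEntered : ∀ {K t} → Descending K → ReachedFromAll K t →
      (L : List (V × V)) → ¬ (Entering (ReachedFromAll K) ⊆ (_∈ L))
    reachedFromAll-infinitelyEntered {K} desc Wt L L-complete =
      let _ , _ , all = descending-pigeonhole (λ n e → K n ↝ proj₁ e × ¬ ReachedFromAll K (proj₁ e))
                          (λ (Kₙ₊₁↝y , ¬Wy) → proj₁ (desc _) ++ʷ Kₙ₊₁↝y , ¬Wy) L crossing-edge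
      in proj₂ (all 0) (λ n → proj₁ (all n))
      where
      crossing-edge : ∀ n → ∃ λ e → e ∈ L × (K n ↝ proj₁ e × ¬ ReachedFromAll K (proj₁ e))
      crossing-edge n =
        let e , Kₙ↝y , entering , _ = walk-crossing (ReachedFromAll K) (Wt n)
                                        (λ WKₙ → proj₂ (desc n) (WKₙ (suc n))) Wt
        in e , L-complete entering , Kₙ↝y , proj₁ entering

    no-descending-chain : ∀ {x₀} → x₀ ∈ X → (K : ℕ → V) → ¬ Descending K
    no-descending-chain {x₀} x₀∈X K desc =
      let t , Wt = reachedFromAll-nonempty x₀∈X desc
          L , L-complete = entering-cover {P = ReachedFromAll K} {t} {x₀} Wt (λ Wx₀ → target∉ (Wx₀ 0) x₀∈X)
                             (leaving-cover-in λ Wu e v∉X n → extend (Wu n) e v∉X)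
      in reachedFromAll-infinitelyEntered desc Wt L L-complete

    solid-nonempty : ∀ {x₀} → x₀ ∈ X → FinitelyManyStrongComponents D X
    solid-nonempty x₀∈X = dne λ not-solid →
      let _ , infinite = some-reachesInfinitelyMany not-solid
          K , desc = infinite-chain _≻_ (descend x₀∈X) infinite
      in no-descending-chain x₀∈X K desc
      where
      -- FinitelyManyStrongComponents D X is ComponentCover (_∉ X).
      some-reachesInfinitelyMany : ¬ FinitelyManyStrongComponents D X → ∃ ReachesInfinitelyMany
      some-reachesInfinitelyMany not-solid = dne λ none →
        let rs , rs∉X , covered = cover-⋃ (λ e → proj₂ e ↝_) (edgesOutOf X)
        in not-solid (rs , rs∉X , λ v v∉X →
             let e , e∈ , h↝v = reached-from-X x₀∈X v∉X
             in covered v (e , e∈ , dne (λ inf → none (_ , inf)) , h↝v))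

  module _ where
    open Avoiding []

    solid-[] : FinitelyManyStrongComponents D []
    solid-[] with em {V}
    ... | no ¬V = [] , (λ _ ()) , λ v _ → ⊥-elim (¬V v)
    ... | yes r = r ∷ [] , (λ { _ (here refl) () }) , λ v _ → r , here refl , reaches v , reached v
      where
      reached : ∀ v → r ↝ v
      reached v = dne λ ¬r↝v →
        let _ , leaving = some-edge-leaves {P = r ↝_} (stay λ ()) ¬r↝v
        in ¬Any[] (leaving-head∈X reachable-forwardClosed leaving)
      reaches : ∀ v → v ↝ r
      reaches v = dne λ ¬v↝r →
        let _ , leaving = some-edge-leaves {P = λ w → ¬ w ↝ r} ¬v↝r (λ ¬r↝r → ¬r↝r (stay λ ()))
        in ¬Any[] (leaving-tail∈X reaching-backwardClosed leaving)

  solid : Solid D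
  solid []      = solid-[]
  solid (x ∷ X) = Avoiding.solid-nonempty (x ∷ X) (here refl)

lemma5p2 : ExcludedMiddle 0ℓ → (D : Digraph) →
    UnderlyingConnected D → LocallyFinite D →
    (∀ (S : Digraph.V D → Bool) → IsCut D S → FiniteCut D S → BalancedCut D S) →
    Solid D
lemma5p2 em D conn lf bal = Solidity.solid em D conn lf bal
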